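{- Let $R$ be a ring and $\tau\in\mathbf{M}_{\mathrm{stab}}(R)$. For each $R$-algebra $R'$, $$\mathbf{H}(R')\mathbf{G}_\tau(R')=\{g\in\mathbf{G}(R'):\ [e^*\bullet]^{ -1}(e^*g)\,[\bullet e]^{ -1}(g^{ -1}e)=1\}.$$ In particular, $R'\mapsto\mathbf{H}(R')\mathbf{G}_\tau(R')$ defines a closed subscheme of $\mathbf{G}$ over $R$.
   Context: Rings are commutative with $1$. Let $\mathbf{V}$ be a free $\mathbb{Z}$-module of finite rank, $\mathbf{V}^*=\mathrm{Hom}(\mathbf{V},\mathbb{Z})$; fix $e\in\mathbf{V}$, $e^*\in\mathbf{V}^*$ with $e^*(e)=1$. For a ring $R$: $\mathbf{V}(R)=\mathbf{V}\otimes R$, $\mathbf{V}^*(R)=\mathrm{Hom}_R(\mathbf{V}(R),R)$, $\mathbf{M}(R)=\mathrm{End}_R(\mathbf{V}(R))$, $\mathbf{G}(R)=\mathrm{Aut}_R(\mathbf{V}(R))$ (the affine group scheme $\mathrm{GL}(\mathbf{V})$). Juxtaposition: $xv=x(v)$, $\ell x=\ell\circ x$. $\mathbf{V}_H(R)=\{v:e^*v=0\}$; $\mathbf{H}(R)=\mathrm{Aut}_R(\mathbf{V}_H(R))$ acting trivially on $Re$ (i.e. $\{g:ge=e,\ e^*g=e^*\}$). For an $R$-algebra $R'$, $\mathbf{G}_\tau(R')$, $\mathbf{M}_\tau(R')$ are the centralizers of $\tau$ in $\mathbf{G}(R')$, $\mathbf{M}(R')$. $\tau$ is stable if $R[\tau]e=\mathbf{V}(R)$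 and $e^*R[\tau]=\mathbf{V}^*(R)$; $\mathbf{M}_{\mathrm{stab}}(R)$ = stable elements. For stable $\tau$ and any $R$-algebra $R'$, the maps $\mathbf{M}_\tau(R')\to\mathbf{V}(R')$, $x\mapsto xe$, and $\mathbf{M}_\tau(R')\to\mathbf{V}^*(R')$, $x\mapsto e^*x$, are $R'$-linear bijections; $[\bullet e]^{ -1}$ and $[e^*\bullet]^{ -1}$ denote their inverses. -}

module Defs where

open import Level using (Level; _⊔_)
open import Data.Nat using (ℕ; zero; suc)
open import Data.Fin using (Fin; zero; suc)
open import Data.Integer as ℤ using (ℤ; +_; -[1+_])
open import Data.List using (List; []; _∷_)
open import Data.Product using (Σ; ∃; _×_; _,_)
open import Data.Sum using (_⊎_; inj₁; inj₂)
open import Algebra.Bundles using (CommutativeRing)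
open import Algebra.Morphism.Structures using (module RingMorphisms)

-- Fix V = ℤ^n (free ℤ-module of rank n, with its standard basis).
-- Vectors of V(R) are columns  Fin n → R ; elements of V*(R) are rows  Fin n → R
-- (ℓ v = Σ_i ℓ_i v_i); M(R) = n×n matrices  Fin n → Fin n → R.

sumℤ : (n : ℕ) → (Fin n → ℤ) → ℤ
sumℤ zero    f = + 0
sumℤ (suc n) f = f zero ℤ.+ sumℤ n (λ i → f (suc i))

pairℤ : (n : ℕ) → (Fin n → ℤ) → (Fin n → ℤ) → ℤ
pairℤ n ℓ v = sumℤ n (λ i → ℓ i ℤ.* v i)

module MatOps {c ℓ : Level} (R : CommutativeRing c ℓ) where
  open CommutativeRing R using (Carrier; _≈_; _+_; _*_; -_; 0#; 1#)

  Vec' : ℕ → Set c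
  Vec' n = Fin n → Carrier

  Mat : ℕ → Set c
  Mat n = Fin n → Fin n → Carrier

  sumR : (n : ℕ) → (Fin n → Carrier) → Carrier
  sumR zero    f = 0#
  sumR (suc n) f = f zero + sumR n (λ i → f (suc i))

  fromℕ : ℕ → Carrier
  fromℕ zero    = 0#
  fromℕ (suc k) = 1# + fromℕ k

  fromℤ : ℤ → Carrier
  fromℤ (+ k)      = fromℕ k
  fromℤ -[1+ k ]   = - (1# + fromℕ k)

  vecℤ : {n : ℕ} → (Fin n → ℤ) → Vec' n
  vecℤ v i = fromℤ (v i)

  _≈V_ : {n : ℕ} → Vec' n → Vec' n → Set ℓ
  u ≈V v = ∀ i → u i ≈ v i

  _≈M_ : {n : ℕ} → Mat n → Mat n → Set ℓ
  x ≈M y = ∀ i j → x i j ≈ y i j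

  idM : {n : ℕ} → Mat n
  idM {suc n} zero    zero    = 1#
  idM {suc n} zero    (suc j) = 0#
  idM {suc n} (suc i) zero    = 0#
  idM {suc n} (suc i) (suc j) = idM {n} i j

  zeroM : {n : ℕ} → Mat n
  zeroM i j = 0#

  _+M_ : {n : ℕ} → Mat n → Mat n → Mat n
  (x +M y) i j = x i j + y i j

  scal : {n : ℕ} → Carrier → Mat n → Mat n
  scal a x i j = a * x i j

  _·M_ : {n : ℕ} → Mat n → Mat n → Mat n
  _·M_ {n} x y i j = sumR n (λ k → x i k * y k j)

  _·V_ : {n : ℕ} → Mat n → Vec' n → Vec' n
  _·V_ {n} x v i = sumR n (λ k → x i k * v k)

  _V·_ : {n : ℕ} → Vec' n → Mat n → Vec' n
  _V·_ {n} l x j = sumR n (λ k → l k * x k j)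

  -- p(τ) for p = a₀ ∷ a₁ ∷ … (coefficients, lowest degree first): Σ aᵢ τⁱ
  evalPoly : {n : ℕ} → List Carrier → Mat n → Mat n
  evalPoly []      τ = zeroM
  evalPoly (a ∷ p) τ = scal a idM +M (τ ·M evalPoly p τ)

  Stable : (n : ℕ) → (e e* : Fin n → ℤ) → Mat n → Set (c ⊔ ℓ)
  Stable n e e* τ =
    (∀ (v : Vec' n) → ∃ λ (p : List Carrier) → (evalPoly p τ ·V vecℤ e) ≈V v)
    × (∀ (l : Vec' n) → ∃ λ (p : List Carrier) → (vecℤ e* V· evalPoly p τ) ≈V l)

  IsInv : {n : ℕ} → Mat n → Mat n → Set ℓ
  IsInv g ginv = ((g ·M ginv) ≈M idM) × ((ginv ·M g) ≈M idM)

  Commutes : {n : ℕ} → Mat n → Mat n → Set ℓ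
  Commutes τ x = (x ·M τ) ≈M (τ ·M x)

  InG : {n : ℕ} → Mat n → Set (c ⊔ ℓ)
  InG g = ∃ λ ginv → IsInv g ginv

  InH : (n : ℕ) → (e e* : Fin n → ℤ) → Mat n → Set (c ⊔ ℓ)
  InH n e e* h = InG h × ((h ·V vecℤ e) ≈V vecℤ e) × ((vecℤ e* V· h) ≈V vecℤ e*)

  InGτ : {n : ℕ} → Mat n → Mat n → Set (c ⊔ ℓ)
  InGτ τ k = InG k × Commutes τ k

  InHGτ : (n : ℕ) → (e e* : Fin n → ℤ) → Mat n → Mat n → Set (c ⊔ ℓ)
  InHGτ n e e* τ g =
    ∃ λ h → ∃ λ k → InH n e e* h × InGτ τ k × (g ≈M (h ·M k))

  -- [e*•]^{-1}(e* g) [•e]^{-1}(g^{-1} e) = 1 : for the elements x, y of M_τ(R)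
  -- with e* x = e* g and y e = g^{-1} e (unique, by the bijectivity in the
  -- context), x y = 1.
  Criterion : (n : ℕ) → (e e* : Fin n → ℤ) → Mat n → Mat n → Mat n → Set (c ⊔ ℓ)
  Criterion n e e* τ g ginv =
    ∀ (x y : Mat n) → Commutes τ x → Commutes τ y →
      (vecℤ e* V· x) ≈V (vecℤ e* V· g) →
      (y ·V vecℤ e) ≈V (ginv ·V vecℤ e) →
      (x ·M y) ≈M idM

record Algebra' {c ℓ : Level} (R : CommutativeRing c ℓ) (c' ℓ' : Level)
       : Set (c ⊔ ℓ ⊔ Level.suc (c' ⊔ ℓ')) where
  field
    ring : CommutativeRing c' ℓ'
    φ    : CommutativeRing.Carrier R → CommutativeRing.Carrier ring
    isHom : RingMorphisms.IsRingHomomorphism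
              (CommutativeRing.rawRing R) (CommutativeRing.rawRing ring) φ

baseMat : {c ℓ c' ℓ' : Level} {R : CommutativeRing c ℓ} → (A : Algebra' R c' ℓ') →
          {n : ℕ} → MatOps.Mat R n → MatOps.Mat (Algebra'.ring A) n
baseMat A τ i j = Algebra'.φ A (τ i j)

-- Polynomials with coefficients in R in the variables Var n, the entries of
-- g (inj₁ (i , j)) and of g^{-1} (inj₂ (i , j)): coordinates on G = GL(V).
Var : ℕ → Set
Var n = (Fin n × Fin n) ⊎ (Fin n × Fin n)

data Poly {c ℓ : Level} (R : CommutativeRing c ℓ) (n : ℕ) : Set c where
  var  : Var n → Poly R n
  con  : CommutativeRing.Carrier R → Poly R n
  _⊕_  : Poly R n → Poly R n → Poly R n
  _⊗_  : Poly R n → Poly R n → Poly R n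
  ⊝_   : Poly R n → Poly R n

evalAt : {c ℓ c' ℓ' : Level} {R : CommutativeRing c ℓ} → (A : Algebra' R c' ℓ') →
         {n : ℕ} → Poly R n →
         MatOps.Mat (Algebra'.ring A) n → MatOps.Mat (Algebra'.ring A) n →
         CommutativeRing.Carrier (Algebra'.ring A)
evalAt A (var (inj₁ (i , j))) g ginv = g i j
evalAt A (var (inj₂ (i , j))) g ginv = ginv i j
evalAt A (con a)  g ginv = Algebra'.φ A a
evalAt A (p ⊕ q)  g ginv = CommutativeRing._+_ (Algebra'.ring A) (evalAt A p g ginv) (evalAt A q g ginv)
evalAt A (p ⊗ q)  g ginv = CommutativeRing._*_ (Algebra'.ring A) (evalAt A p g ginv) (evalAt A q g ginv)
evalAt A (⊝ p)    g ginv = CommutativeRing.-_ (Algebra'.ring A) (evalAt A p g ginv)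

-- Stability gives, for each m, elements row m and col m of R[τ] with e* (row m) and (col m) e the
-- m-th coordinate form and basis vector. An x commuting with τ is then determined by e* x (its i-th
-- row is (e* x) (row i)) and by x e, and [e*•]⁻¹, [•e]⁻¹ are linear combinations of the row m, col m.
-- Put x = [e*•]⁻¹ (e* g), y = [•e]⁻¹ (g⁻¹ e). If g = h k with h ∈ H and k ∈ G_τ, then e* g = e* k and
-- g⁻¹ e = k⁻¹ e, so x = k, y = k⁻¹ and x y = 1. Conversely, if x y = 1 then also y x = 1, and
-- g = (g y) x with g y ∈ H and x ∈ G_τ. The entries of x y - 1 are polynomials
-- over R in the entries of g and g⁻¹, and they cut out H G_τ.

module Submission where

open import Defs
open import Level using (Level; _⊔_; Lift; lift)
open import Function using (_∘_)
open import Data.Nat using (ℕ; zero; suc)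
open import Data.Fin using (Fin; zero; suc)
open import Data.Integer using (ℤ; +_; -[1+_])
open import Data.List using (List; []; _∷_)
import Data.List as List
open import Data.Product using (Σ; _×_; _,_; proj₁; proj₂)
open import Data.Sum using (inj₁; inj₂)
open import Relation.Binary.Bundles using (Setoid)
open import Relation.Binary.PropositionalEquality using (_≡_)
import Relation.Binary.Reasoning.Setoid as ≈-Reasoning
open import Algebra.Bundles using (CommutativeRing; Monoid)
open import Algebra.Morphism.Structures using (module RingMorphisms)

module MatrixAlgebra {c ℓ : Level} (S : CommutativeRing c ℓ) where
  open CommutativeRing S hiding (zero)
  open MatOps S
  open import Algebra.Properties.CommutativeSemigroup +-commutativeSemigroup using (interchange)
  open import Algebra.Properties.CommutativeSemigroup *-commutativeSemigroup using (x∙yz≈y∙xz)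
  open import Data.Vec.Functional.Relation.Binary.Equality.Setoid setoid
    using () renaming (≋-setoid to Vec-setoid) public
  open import Data.Vec.Functional.Relation.Binary.Equality.Setoid using (≋-setoid)

  Mat-setoid : ℕ → Setoid c ℓ
  Mat-setoid n = ≋-setoid (Vec-setoid n) n

  module _ {n : ℕ} where
    open Setoid (Mat-setoid n) public using ()
      renaming (refl to ≈M-refl; sym to ≈M-sym; trans to ≈M-trans)
    open Setoid (Vec-setoid n) public using ()
      renaming (refl to ≈V-refl; sym to ≈V-sym; trans to ≈V-trans)

  sumR-cong : ∀ n {f g : Fin n → Carrier} → (∀ i → f i ≈ g i) → sumR n f ≈ sumR n g
  sumR-cong zero    f≈g = refl
  sumR-cong (suc n) f≈g = +-cong (f≈g zero) (sumR-cong n (f≈g ∘ suc))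

  sumR-zero : ∀ n → sumR n (λ _ → 0#) ≈ 0#
  sumR-zero zero    = refl
  sumR-zero (suc n) = trans (+-congˡ (sumR-zero n)) (+-identityˡ 0#)

  sumR-distrib-+ : ∀ n (f g : Fin n → Carrier) → sumR n (λ i → f i + g i) ≈ sumR n f + sumR n g
  sumR-distrib-+ zero    f g = sym (+-identityˡ 0#)
  sumR-distrib-+ (suc n) f g = trans (+-congˡ (sumR-distrib-+ n _ _)) (interchange _ _ _ _)

  sumR-comm : ∀ n m (f : Fin n → Fin m → Carrier) →
    sumR n (λ i → sumR m (f i)) ≈ sumR m (λ j → sumR n (λ i → f i j))
  sumR-comm zero    m f = sym (sumR-zero m)
  sumR-comm (suc n) m f = trans (+-congˡ (sumR-comm n m (f ∘ suc))) (sym (sumR-distrib-+ m _ _))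

  *-distribˡ-sumR : ∀ n a (f : Fin n → Carrier) → a * sumR n f ≈ sumR n (λ i → a * f i)
  *-distribˡ-sumR zero    a f = zeroʳ a
  *-distribˡ-sumR (suc n) a f = trans (distribˡ a _ _) (+-congˡ (*-distribˡ-sumR n a _))

  *-distribʳ-sumR : ∀ n a (f : Fin n → Carrier) → sumR n f * a ≈ sumR n (λ i → f i * a)
  *-distribʳ-sumR zero    a f = zeroˡ a
  *-distribʳ-sumR (suc n) a f = trans (distribʳ a _ _) (+-congˡ (*-distribʳ-sumR n a _))

  sumR-idMˡ : ∀ n (i : Fin n) (v : Fin n → Carrier) → sumR n (λ k → idM i k * v k) ≈ v i
  sumR-idMˡ (suc n) zero v = trans
    (+-cong (*-identityˡ _) (trans (sumR-cong n (λ _ → zeroˡ _)) (sumR-zero n))) (+-identityʳ _)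
  sumR-idMˡ (suc n) (suc i) v =
    trans (+-cong (zeroˡ _) (sumR-idMˡ n i (v ∘ suc))) (+-identityˡ _)

  sumR-idMʳ : ∀ n (j : Fin n) (v : Fin n → Carrier) → sumR n (λ k → v k * idM k j) ≈ v j
  sumR-idMʳ (suc n) zero v = trans
    (+-cong (*-identityʳ _) (trans (sumR-cong n (λ _ → zeroʳ _)) (sumR-zero n))) (+-identityʳ _)
  sumR-idMʳ (suc n) (suc j) v =
    trans (+-cong (zeroʳ _) (sumR-idMʳ n j (v ∘ suc))) (+-identityˡ _)

  sumR-*-assoc : ∀ n m (a : Fin n → Carrier) (b : Fin n → Fin m → Carrier) (d : Fin m → Carrier) →
    sumR n (λ k → a k * sumR m (λ l → b k l * d l)) ≈ sumR m (λ l → sumR n (λ k → a k * b k l) * d l)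
  sumR-*-assoc n m a b d = begin
    sumR n (λ k → a k * sumR m (λ l → b k l * d l))   ≈⟨ sumR-cong n (λ k → *-distribˡ-sumR m (a k) _) ⟩
    sumR n (λ k → sumR m (λ l → a k * (b k l * d l))) ≈⟨ sumR-comm n m _ ⟩
    sumR m (λ l → sumR n (λ k → a k * (b k l * d l))) ≈⟨ sumR-cong m (λ l → sumR-cong n (λ k → sym (*-assoc _ _ _))) ⟩
    sumR m (λ l → sumR n (λ k → (a k * b k l) * d l)) ≈⟨ sumR-cong m (λ l → sym (*-distribʳ-sumR n (d l) _)) ⟩
    sumR m (λ l → sumR n (λ k → a k * b k l) * d l)   ∎
    where open ≈-Reasoning setoid

  sumR-*-swap : ∀ n m (a : Fin n → Carrier) (b : Fin m → Carrier) (d : Fin m → Fin n → Carrier) →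
    sumR n (λ k → a k * sumR m (λ l → b l * d l k)) ≈ sumR m (λ l → b l * sumR n (λ k → a k * d l k))
  sumR-*-swap n m a b d = begin
    sumR n (λ k → a k * sumR m (λ l → b l * d l k))   ≈⟨ sumR-cong n (λ k → *-distribˡ-sumR m (a k) _) ⟩
    sumR n (λ k → sumR m (λ l → a k * (b l * d l k))) ≈⟨ sumR-comm n m _ ⟩
    sumR m (λ l → sumR n (λ k → a k * (b l * d l k))) ≈⟨ sumR-cong m (λ l → sumR-cong n (λ k → x∙yz≈y∙xz _ _ _)) ⟩
    sumR m (λ l → sumR n (λ k → b l * (a k * d l k))) ≈⟨ sumR-cong m (λ l → *-distribˡ-sumR n (b l) _) ⟨
    sumR m (λ l → b l * sumR n (λ k → a k * d l k))   ∎
    where open ≈-Reasoning setoid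

  ·M-cong : ∀ {n} {x x' y y' : Mat n} → x ≈M x' → y ≈M y' → (x ·M y) ≈M (x' ·M y')
  ·M-cong {n} x≈ y≈ i j = sumR-cong n (λ k → *-cong (x≈ i k) (y≈ k j))

  ·M-assoc : ∀ {n} (x y z : Mat n) → ((x ·M y) ·M z) ≈M (x ·M (y ·M z))
  ·M-assoc {n} x y z i j = sym (sumR-*-assoc n n (x i) y (λ l → z l j))

  ·M-identityˡ : ∀ {n} (x : Mat n) → (idM ·M x) ≈M x
  ·M-identityˡ {n} x i j = sumR-idMˡ n i (λ k → x k j)

  ·M-identityʳ : ∀ {n} (x : Mat n) → (x ·M idM) ≈M x
  ·M-identityʳ {n} x i j = sumR-idMʳ n j (x i)

  Mat-monoid : ℕ → Monoid c ℓ
  Mat-monoid n = record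
    { Carrier  = Mat n
    ; _≈_      = _≈M_
    ; _∙_      = _·M_
    ; ε        = idM
    ; isMonoid = record
      { isSemigroup = record
        { isMagma = record { isEquivalence = Setoid.isEquivalence (Mat-setoid n) ; ∙-cong = ·M-cong }
        ; assoc   = ·M-assoc }
      ; identity = ·M-identityˡ , ·M-identityʳ } }

  V·-cong : ∀ {n} {v v' : Vec' n} {x x' : Mat n} → v ≈V v' → x ≈M x' → (v V· x) ≈V (v' V· x')
  V·-cong {n} v≈ x≈ j = sumR-cong n (λ k → *-cong (v≈ k) (x≈ k j))

  ·V-cong : ∀ {n} {x x' : Mat n} {v v' : Vec' n} → x ≈M x' → v ≈V v' → (x ·V v) ≈V (x' ·V v')
  ·V-cong {n} x≈ v≈ i = sumR-cong n (λ k → *-cong (x≈ i k) (v≈ k))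

  V·-·M-assoc : ∀ {n} (v : Vec' n) (x y : Mat n) → ((v V· x) V· y) ≈V (v V· (x ·M y))
  V·-·M-assoc {n} v x y j = sym (sumR-*-assoc n n v x (λ l → y l j))

  ·M-·V-assoc : ∀ {n} (x y : Mat n) (v : Vec' n) → ((x ·M y) ·V v) ≈V (x ·V (y ·V v))
  ·M-·V-assoc {n} x y v i = sym (sumR-*-assoc n n (x i) y v)

  V·-identityʳ : ∀ {n} (v : Vec' n) → (v V· idM) ≈V v
  V·-identityʳ {n} v j = sumR-idMʳ n j v

  ·V-identityˡ : ∀ {n} (v : Vec' n) → (idM ·V v) ≈V v
  ·V-identityˡ {n} v i = sumR-idMˡ n i v

  +M-cong : ∀ {n} {x x' y y' : Mat n} → x ≈M x' → y ≈M y' → (x +M y) ≈M (x' +M y')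
  +M-cong x≈ y≈ i j = +-cong (x≈ i j) (y≈ i j)

  ·M-distribʳ-+M : ∀ {n} (x y z : Mat n) → ((y +M z) ·M x) ≈M ((y ·M x) +M (z ·M x))
  ·M-distribʳ-+M {n} x y z i j = trans (sumR-cong n (λ k → distribʳ _ _ _)) (sumR-distrib-+ n _ _)

  ·M-distribˡ-+M : ∀ {n} (x y z : Mat n) → (x ·M (y +M z)) ≈M ((x ·M y) +M (x ·M z))
  ·M-distribˡ-+M {n} x y z i j = trans (sumR-cong n (λ k → distribˡ _ _ _)) (sumR-distrib-+ n _ _)

  scal-idM-·M : ∀ {n} a (x : Mat n) → (scal a idM ·M x) ≈M scal a x
  scal-idM-·M {n} a x i j = begin
    sumR n (λ k → (a * idM i k) * x k j) ≈⟨ sumR-cong n (λ k → *-assoc _ _ _) ⟩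
    sumR n (λ k → a * (idM i k * x k j)) ≈⟨ *-distribˡ-sumR n a _ ⟨
    a * sumR n (λ k → idM i k * x k j)   ≈⟨ *-congˡ (sumR-idMˡ n i (λ k → x k j)) ⟩
    a * x i j                            ∎
    where open ≈-Reasoning setoid

  ·M-scal-idM : ∀ {n} a (x : Mat n) → (x ·M scal a idM) ≈M scal a x
  ·M-scal-idM {n} a x i j = begin
    sumR n (λ k → x i k * (a * idM k j)) ≈⟨ sumR-cong n (λ k → x∙yz≈y∙xz _ _ _) ⟩
    sumR n (λ k → a * (x i k * idM k j)) ≈⟨ *-distribˡ-sumR n a _ ⟨
    a * sumR n (λ k → x i k * idM k j)   ≈⟨ *-congˡ (sumR-idMʳ n j (x i)) ⟩
    a * x i j                            ∎
    where open ≈-Reasoning setoid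

  ·M-zeroˡ : ∀ {n} (x : Mat n) → (zeroM ·M x) ≈M zeroM
  ·M-zeroˡ {n} x i j = trans (sumR-cong n (λ _ → zeroˡ _)) (sumR-zero n)

  ·M-zeroʳ : ∀ {n} (x : Mat n) → (x ·M zeroM) ≈M zeroM
  ·M-zeroʳ {n} x i j = trans (sumR-cong n (λ _ → zeroʳ _)) (sumR-zero n)

  LC : ∀ {n} → Vec' n → (Fin n → Mat n) → Mat n
  LC {n} a P i j = sumR n (λ m → a m * P m i j)

  LC-cong : ∀ {n} (a : Vec' n) {P P' : Fin n → Mat n} → (∀ m → P m ≈M P' m) → LC a P ≈M LC a P'
  LC-cong {n} a P≈ i j = sumR-cong n (λ m → *-congˡ (P≈ m i j))

  LC-·M : ∀ {n} (a : Vec' n) (P : Fin n → Mat n) (y : Mat n) → (LC a P ·M y) ≈M LC a (λ m → P m ·M y)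
  LC-·M {n} a P y i j = sym (sumR-*-assoc n n a (λ m k → P m i k) (λ k → y k j))

  ·M-LC : ∀ {n} (a : Vec' n) (P : Fin n → Mat n) (y : Mat n) → (y ·M LC a P) ≈M LC a (λ m → y ·M P m)
  ·M-LC {n} a P y i j = sumR-*-swap n n (y i) a (λ m k → P m k j)

  V·-LC : ∀ {n} (a : Vec' n) (P : Fin n → Mat n) (v : Vec' n) →
    (v V· LC a P) ≈V (λ j → sumR n (λ m → a m * (v V· P m) j))
  V·-LC {n} a P v j = sumR-*-swap n n v a (λ m k → P m k j)

  LC-·V : ∀ {n} (a : Vec' n) (P : Fin n → Mat n) (v : Vec' n) →
    (LC a P ·V v) ≈V (λ i → sumR n (λ m → a m * (P m ·V v) i))
  LC-·V {n} a P v i = sym (sumR-*-assoc n n a (λ m k → P m i k) v)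

  IsInv-sym : ∀ {n} {g g' : Mat n} → IsInv g g' → IsInv g' g
  IsInv-sym (gg' , g'g) = g'g , gg'

  IsInv-·M : ∀ {n} {a a' b b' : Mat n} → IsInv a a' → IsInv b b' → IsInv (a ·M b) (b' ·M a')
  IsInv-·M {n} (aa' , a'a) (bb' , b'b) = ≈M-trans (cancelᶜ bb' _ _) aa' , ≈M-trans (cancelᶜ a'a _ _) b'b
    where open import Algebra.Properties.Monoid (Mat-monoid n) using (cancelᶜ)

  inverse-·V : ∀ {n} {g g' : Mat n} {v w : Vec' n} → IsInv g g' → (g ·V v) ≈V w → (g' ·V w) ≈V v
  inverse-·V {n} {g} {g'} {v} {w} (_ , g'g) gv≈w = begin
    g' ·V w          ≈⟨ ·V-cong ≈M-refl gv≈w ⟨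
    g' ·V (g ·V v)   ≈⟨ ·M-·V-assoc g' g v ⟨
    (g' ·M g) ·V v   ≈⟨ ·V-cong g'g ≈V-refl ⟩
    idM ·V v         ≈⟨ ·V-identityˡ v ⟩
    v                ∎
    where open ≈-Reasoning (Vec-setoid n)

module Centralizer {c ℓ : Level} (S : CommutativeRing c ℓ) where
  open CommutativeRing S hiding (zero)
  open MatOps S
  open MatrixAlgebra S

  module _ {n : ℕ} where
    open ≈-Reasoning (Mat-setoid n)

    commutes-sym : {x y : Mat n} → Commutes x y → Commutes y x
    commutes-sym = ≈M-sym

    commutes-cong : {x y y' : Mat n} → y ≈M y' → Commutes x y → Commutes x y'
    commutes-cong y≈y' yx≈xy = ≈M-trans (·M-cong (≈M-sym y≈y') ≈M-refl)
                                 (≈M-trans yx≈xy (·M-cong ≈M-refl y≈y'))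

    commutes-zeroM : (x : Mat n) → Commutes x zeroM
    commutes-zeroM x = ≈M-trans (·M-zeroˡ x) (≈M-sym (·M-zeroʳ x))

    commutes-scal-idM : (x : Mat n) (a : Carrier) → Commutes x (scal a idM)
    commutes-scal-idM x a = ≈M-trans (scal-idM-·M a x) (≈M-sym (·M-scal-idM a x))

    commutes-+M : {x y z : Mat n} → Commutes x y → Commutes x z → Commutes x (y +M z)
    commutes-+M {x} {y} {z} yx≈xy zx≈xz = begin
      (y +M z) ·M x         ≈⟨ ·M-distribʳ-+M x y z ⟩
      (y ·M x) +M (z ·M x)  ≈⟨ +M-cong yx≈xy zx≈xz ⟩
      (x ·M y) +M (x ·M z)  ≈⟨ ·M-distribˡ-+M x y z ⟨
      x ·M (y +M z)         ∎

    commutes-·M : {x y z : Mat n} → Commutes x y → Commutes x z → Commutes x (y ·M z)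
    commutes-·M {x} {y} {z} yx≈xy zx≈xz = begin
      (y ·M z) ·M x   ≈⟨ ·M-assoc y z x ⟩
      y ·M (z ·M x)   ≈⟨ ·M-cong ≈M-refl zx≈xz ⟩
      y ·M (x ·M z)   ≈⟨ ·M-assoc y x z ⟨
      (y ·M x) ·M z   ≈⟨ ·M-cong yx≈xy ≈M-refl ⟩
      (x ·M y) ·M z   ≈⟨ ·M-assoc x y z ⟩
      x ·M (y ·M z)   ∎

    commutes-evalPoly : {x τ : Mat n} (p : List Carrier) → Commutes x τ → Commutes x (evalPoly p τ)
    commutes-evalPoly {x}     []      τx≈xτ = commutes-zeroM x
    commutes-evalPoly {x} (a ∷ p) τx≈xτ =
      commutes-+M (commutes-scal-idM x a) (commutes-·M τx≈xτ (commutes-evalPoly p τx≈xτ))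

    commutes-LC : {x : Mat n} (a : Vec' n) {P : Fin n → Mat n} →
      (∀ m → Commutes x (P m)) → Commutes x (LC a P)
    commutes-LC {x} a {P} Px≈xP = begin
      LC a P ·M x             ≈⟨ LC-·M a P x ⟩
      LC a (λ m → P m ·M x)   ≈⟨ LC-cong a Px≈xP ⟩
      LC a (λ m → x ·M P m)   ≈⟨ ·M-LC a P x ⟨
      x ·M LC a P             ∎

    commutes-inverse : {x k k' : Mat n} → IsInv k k' → Commutes x k → Commutes x k'
    commutes-inverse {x} {k} {k'} (kk' , k'k) kx≈xk = begin
      k' ·M x                  ≈⟨ insertʳ kk' _ ⟩
      ((k' ·M x) ·M k) ·M k'   ≈⟨ ·M-cong (·M-assoc k' x k) ≈M-refl ⟩
      (k' ·M (x ·M k)) ·M k'   ≈⟨ ·M-cong (·M-cong ≈M-refl kx≈xk) ≈M-refl ⟨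
      (k' ·M (k ·M x)) ·M k'   ≈⟨ ·M-cong (cancelˡ k'k x) ≈M-refl ⟩
      x ·M k'                  ∎
      where open import Algebra.Properties.Monoid (Mat-monoid n) using (insertʳ; cancelˡ)

record Frame {c ℓ : Level} (S : CommutativeRing c ℓ) {n : ℕ} (e e* : Fin n → ℤ) (τ : MatOps.Mat S n)
       : Set (c ⊔ ℓ) where
  open MatOps S
  field
    row col     : Fin n → Mat n
    row-central : ∀ m {x} → Commutes τ x → Commutes x (row m)
    col-central : ∀ m {x} → Commutes τ x → Commutes x (col m)
    e*-row      : ∀ m → (vecℤ e* V· row m) ≈V idM m
    col-e       : ∀ m → (col m ·V vecℤ e) ≈V (λ i → idM i m)

module Coordinates {c ℓ : Level} {S : CommutativeRing c ℓ} {n : ℕ} {e e* : Fin n → ℤ} {τ : MatOps.Mat S n}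
    (F : Frame S e e* τ) where
  open CommutativeRing S hiding (zero)
  open MatOps S
  open MatrixAlgebra S
  open Centralizer S
  open Frame F
  module ≈V = ≈-Reasoning (Vec-setoid n)

  E E* : Vec' n
  E  = vecℤ e
  E* = vecℤ e*

  [e*•]⁻¹ [•e]⁻¹ : Vec' n → Mat n
  [e*•]⁻¹ a = LC a row
  [•e]⁻¹ b = LC b col

  [e*•]⁻¹-central : ∀ a → Commutes τ ([e*•]⁻¹ a)
  [e*•]⁻¹-central a = commutes-LC a (λ m → row-central m ≈M-refl)

  [•e]⁻¹-central : ∀ b → Commutes τ ([•e]⁻¹ b)
  [•e]⁻¹-central b = commutes-LC b (λ m → col-central m ≈M-refl)

  [e*•]∘[e*•]⁻¹ : ∀ a → (E* V· [e*•]⁻¹ a) ≈V a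
  [e*•]∘[e*•]⁻¹ a j = trans (V·-LC a row E* j)
    (trans (sumR-cong n (λ m → *-congˡ (e*-row m j))) (sumR-idMʳ n j a))

  [•e]∘[•e]⁻¹ : ∀ b → ([•e]⁻¹ b ·V E) ≈V b
  [•e]∘[•e]⁻¹ b i = trans (LC-·V b col E i)
    (trans (sumR-cong n (λ m → trans (*-congˡ (col-e m i)) (*-comm _ _))) (sumR-idMˡ n i b))

  row-of-central : ∀ {x} → Commutes τ x → ∀ i → x i ≈V ((E* V· x) V· row i)
  row-of-central {x} τx≈xτ i = ≈V.begin
    x i                      ≈V.≈⟨ (λ j → sumR-idMˡ n i (λ k → x k j)) ⟨
    idM i V· x               ≈V.≈⟨ V·-cong (≈V-sym (e*-row i)) ≈M-refl ⟩
    (E* V· row i) V· x       ≈V.≈⟨ V·-·M-assoc E* (row i) x ⟩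
    E* V· (row i ·M x)       ≈V.≈⟨ V·-cong ≈V-refl (row-central i τx≈xτ) ⟩
    E* V· (x ·M row i)       ≈V.≈⟨ V·-·M-assoc E* x (row i) ⟨
    (E* V· x) V· row i       ≈V.∎

  column-of-central : ∀ {x} → Commutes τ x → ∀ j → (λ i → x i j) ≈V (col j ·V (x ·V E))
  column-of-central {x} τx≈xτ j = ≈V.begin
    (λ i → x i j)            ≈V.≈⟨ (λ i → sumR-idMʳ n j (x i)) ⟨
    x ·V (λ k → idM k j)     ≈V.≈⟨ ·V-cong ≈M-refl (≈V-sym (col-e j)) ⟩
    x ·V (col j ·V E)        ≈V.≈⟨ ·M-·V-assoc x (col j) E ⟨
    (x ·M col j) ·V E        ≈V.≈⟨ ·V-cong (col-central j τx≈xτ) ≈V-refl ⟨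
    (col j ·M x) ·V E        ≈V.≈⟨ ·M-·V-assoc (col j) x E ⟩
    col j ·V (x ·V E)        ≈V.∎

  [e*•]-injective : ∀ {x x'} → Commutes τ x → Commutes τ x' → (E* V· x) ≈V (E* V· x') → x ≈M x'
  [e*•]-injective {x} {x'} xc x'c e*x≈e*x' i = ≈V.begin
    x i                  ≈V.≈⟨ row-of-central xc i ⟩
    (E* V· x) V· row i   ≈V.≈⟨ V·-cong e*x≈e*x' ≈M-refl ⟩
    (E* V· x') V· row i  ≈V.≈⟨ row-of-central x'c i ⟨
    x' i                 ≈V.∎

  [•e]-injective : ∀ {x x'} → Commutes τ x → Commutes τ x' → (x ·V E) ≈V (x' ·V E) → x ≈M x'
  [•e]-injective {x} {x'} xc x'c xe≈x'e i j = trans (column-of-central xc j i)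
    (trans (·V-cong {x = col j} ≈M-refl xe≈x'e i) (sym (column-of-central x'c j i)))

  criterion⇒product≈idM : ∀ {g g'} → Criterion n e e* τ g g' →
    ([e*•]⁻¹ (E* V· g) ·M [•e]⁻¹ (g' ·V E)) ≈M idM
  criterion⇒product≈idM crit = crit _ _ ([e*•]⁻¹-central _) ([•e]⁻¹-central _)
    ([e*•]∘[e*•]⁻¹ _) ([•e]∘[•e]⁻¹ _)

  product≈idM⇒criterion : ∀ {g g'} → ([e*•]⁻¹ (E* V· g) ·M [•e]⁻¹ (g' ·V E)) ≈M idM →
    Criterion n e e* τ g g'
  product≈idM⇒criterion {g} {g'} xy≈1 x y xc yc e*x≈e*g ye≈g'e = ≈M-trans (·M-cong x≈ y≈) xy≈1
    where
    x≈ : x ≈M [e*•]⁻¹ (E* V· g)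
    x≈ = [e*•]-injective xc ([e*•]⁻¹-central _) (≈V-trans e*x≈e*g (≈V-sym ([e*•]∘[e*•]⁻¹ _)))
    y≈ : y ≈M [•e]⁻¹ (g' ·V E)
    y≈ = [•e]-injective yc ([•e]⁻¹-central _) (≈V-trans ye≈g'e (≈V-sym ([•e]∘[•e]⁻¹ _)))

  HGτ⇒product≈idM : ∀ {g g'} → IsInv g g' → InHGτ n e e* τ g →
    ([e*•]⁻¹ (E* V· g) ·M [•e]⁻¹ (g' ·V E)) ≈M idM
  HGτ⇒product≈idM {g} {g'} gg' (h , k , (_ , he≈e , e*h≈e*) , ((k' , kk') , kc) , g≈hk) =
    ≈M-trans (·M-cong x≈k y≈k') (proj₁ kk')
    where
    e*g≈e*k : (E* V· g) ≈V (E* V· k)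
    e*g≈e*k = ≈V.begin
      E* V· g           ≈V.≈⟨ V·-cong ≈V-refl g≈hk ⟩
      E* V· (h ·M k)    ≈V.≈⟨ V·-·M-assoc E* h k ⟨
      (E* V· h) V· k    ≈V.≈⟨ V·-cong e*h≈e* ≈M-refl ⟩
      E* V· k           ≈V.∎
    gk'e≈e : (g ·V (k' ·V E)) ≈V E
    gk'e≈e = ≈V.begin
      g ·V (k' ·V E)           ≈V.≈⟨ ·V-cong g≈hk ≈V-refl ⟩
      (h ·M k) ·V (k' ·V E)    ≈V.≈⟨ ·M-·V-assoc (h ·M k) k' E ⟨
      ((h ·M k) ·M k') ·V E    ≈V.≈⟨ ·V-cong (cancelʳ (proj₁ kk') h) ≈V-refl ⟩
      h ·V E                   ≈V.≈⟨ he≈e ⟩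
      E                        ≈V.∎
      where open import Algebra.Properties.Monoid (Mat-monoid n) using (cancelʳ)
    x≈k : [e*•]⁻¹ (E* V· g) ≈M k
    x≈k = [e*•]-injective ([e*•]⁻¹-central _) kc (≈V-trans ([e*•]∘[e*•]⁻¹ _) e*g≈e*k)
    y≈k' : [•e]⁻¹ (g' ·V E) ≈M k'
    y≈k' = [•e]-injective ([•e]⁻¹-central _) (commutes-inverse kk' kc)
      (≈V-trans ([•e]∘[•e]⁻¹ _) (inverse-·V gg' gk'e≈e))

  product≈idM⇒HGτ : ∀ {g g'} → IsInv g g' → ([e*•]⁻¹ (E* V· g) ·M [•e]⁻¹ (g' ·V E)) ≈M idM →
    InHGτ n e e* τ g
  product≈idM⇒HGτ {g} {g'} gg' xy≈1 =
    g ·M y , x , (h-invertible , he≈e , e*h≈e*) , ((y , xy≈1 , yx≈1) , [e*•]⁻¹-central _) , g≈hx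
    where
    x = [e*•]⁻¹ (E* V· g)
    y = [•e]⁻¹ (g' ·V E)
    -- y commutes with τ, hence with every row m, hence with x
    yx≈1 : (y ·M x) ≈M idM
    yx≈1 = ≈M-trans (≈M-sym (commutes-LC (E* V· g) (λ m → row-central m ([•e]⁻¹-central _)))) xy≈1
    h-invertible : InG (g ·M y)
    h-invertible = x ·M g' , IsInv-·M gg' (yx≈1 , xy≈1)
    he≈e : ((g ·M y) ·V E) ≈V E
    he≈e = ≈V-trans (·M-·V-assoc g y E)
             (≈V-trans (·V-cong ≈M-refl ([•e]∘[•e]⁻¹ _)) (inverse-·V (IsInv-sym gg') ≈V-refl))
    e*h≈e* : (E* V· (g ·M y)) ≈V E*
    e*h≈e* = ≈V.begin
      E* V· (g ·M y)   ≈V.≈⟨ V·-·M-assoc E* g y ⟨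
      (E* V· g) V· y   ≈V.≈⟨ V·-cong ([e*•]∘[e*•]⁻¹ _) ≈M-refl ⟨
      (E* V· x) V· y   ≈V.≈⟨ V·-·M-assoc E* x y ⟩
      E* V· (x ·M y)   ≈V.≈⟨ V·-cong ≈V-refl xy≈1 ⟩
      E* V· idM        ≈V.≈⟨ V·-identityʳ E* ⟩
      E*               ≈V.∎
    g≈hx : g ≈M ((g ·M y) ·M x)
    g≈hx = insertʳ yx≈1 g
      where open import Algebra.Properties.Monoid (Mat-monoid n) using (insertʳ)

module BaseChange {c ℓ c' ℓ' : Level} {R : CommutativeRing c ℓ} (A : Algebra' R c' ℓ') where
  open Algebra' A using (φ; isHom) renaming (ring to R')
  private
    module R = CommutativeRing R
    module MR = MatOps R
  open CommutativeRing R' hiding (zero)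
  open MatOps R'
  open MatrixAlgebra R'
  open RingMorphisms R.rawRing (CommutativeRing.rawRing R')
  open IsRingHomomorphism isHom public using (⟦⟧-cong; 0#-homo; 1#-homo; +-homo; *-homo; -‿homo)

  φ-sumR : ∀ n (f : Fin n → R.Carrier) → φ (MR.sumR n f) ≈ sumR n (φ ∘ f)
  φ-sumR zero    f = 0#-homo
  φ-sumR (suc n) f = trans (+-homo _ _) (+-congˡ (φ-sumR n _))

  φ-fromℕ : ∀ k → φ (MR.fromℕ k) ≈ fromℕ k
  φ-fromℕ zero    = 0#-homo
  φ-fromℕ (suc k) = trans (+-homo _ _) (+-cong 1#-homo (φ-fromℕ k))

  φ-fromℤ : ∀ k → φ (MR.fromℤ k) ≈ fromℤ k
  φ-fromℤ (+ k)    = φ-fromℕ k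
  φ-fromℤ -[1+ k ] = trans (-‿homo _) (-‿cong (φ-fromℕ (suc k)))

  baseMat-idM : ∀ {n} → baseMat A (MR.idM {n}) ≈M idM
  baseMat-idM {suc n} zero    zero    = 1#-homo
  baseMat-idM {suc n} zero    (suc j) = 0#-homo
  baseMat-idM {suc n} (suc i) zero    = 0#-homo
  baseMat-idM {suc n} (suc i) (suc j) = baseMat-idM {n} i j

  baseMat-·M : ∀ {n} (x y : MR.Mat n) → baseMat A (x MR.·M y) ≈M (baseMat A x ·M baseMat A y)
  baseMat-·M {n} x y i j = trans (φ-sumR n _) (sumR-cong n (λ k → *-homo _ _))

  baseMat-evalPoly : ∀ {n} (p : List R.Carrier) (τ : MR.Mat n) →
    baseMat A (MR.evalPoly p τ) ≈M evalPoly (List.map φ p) (baseMat A τ)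
  baseMat-evalPoly []      τ i j = 0#-homo
  baseMat-evalPoly (a ∷ p) τ i j = trans (+-homo _ _) (+-cong
    (trans (*-homo _ _) (*-congˡ (baseMat-idM i j)))
    (trans (baseMat-·M τ (MR.evalPoly p τ) i j) (·M-cong {x = baseMat A τ} ≈M-refl (baseMat-evalPoly p τ) i j)))

  V·-baseMat : ∀ {n} (e* : Fin n → ℤ) (x : MR.Mat n) →
    (vecℤ e* V· baseMat A x) ≈V (φ ∘ (MR.vecℤ e* MR.V· x))
  V·-baseMat {n} e* x j = sym (trans (φ-sumR n _)
    (sumR-cong n (λ k → trans (*-homo _ _) (*-congʳ (φ-fromℤ (e* k))))))

  baseMat-·V : ∀ {n} (e : Fin n → ℤ) (x : MR.Mat n) →
    (baseMat A x ·V vecℤ e) ≈V (φ ∘ (x MR.·V MR.vecℤ e))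
  baseMat-·V {n} e x i = sym (trans (φ-sumR n _)
    (sumR-cong n (λ k → trans (*-homo _ _) (*-congˡ (φ-fromℤ (e k))))))

module StableEndomorphism {c ℓ : Level} (R : CommutativeRing c ℓ) {n : ℕ} (e e* : Fin n → ℤ)
    (τ : MatOps.Mat R n) (stable : MatOps.Stable R n e e* τ) where
  module MR = MatOps R

  rowR colR : Fin n → MR.Mat n
  rowR m = MR.evalPoly (proj₁ (proj₂ stable (MR.idM m))) τ
  colR m = MR.evalPoly (proj₁ (proj₁ stable (λ i → MR.idM i m))) τ

  ∑P : ∀ k → (Fin k → Poly R n) → Poly R n
  ∑P zero    f = con (CommutativeRing.0# R)
  ∑P (suc k) f = f zero ⊕ ∑P k (f ∘ suc)

  LCP : (Fin n → Poly R n) → (Fin n → MR.Mat n) → Fin n → Fin n → Poly R n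
  LCP a P i j = ∑P n (λ m → a m ⊗ con (P m i j))

  e*gP g'eP : Fin n → Poly R n
  e*gP m = ∑P n (λ k → con (MR.fromℤ (e* k)) ⊗ var (inj₁ (k , m)))
  g'eP m = ∑P n (λ k → var (inj₂ (m , k)) ⊗ con (MR.fromℤ (e k)))

  criterionPoly : Lift c (Fin n × Fin n) → Poly R n
  criterionPoly (lift (i , j)) =
    ∑P n (λ k → LCP e*gP rowR i k ⊗ LCP g'eP colR k j) ⊕ (⊝ con (MR.idM i j))

  module _ {c' ℓ' : Level} (A : Algebra' R c' ℓ') where
    open Algebra' A using (φ) renaming (ring to R')
    open CommutativeRing R' hiding (zero)
    open MatOps R'
    open MatrixAlgebra R'
    open Centralizer R'
    open BaseChange A

    frame : Frame R' e e* (baseMat A τ)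
    frame = record
      { row         = λ m → baseMat A (rowR m)
      ; col         = λ m → baseMat A (colR m)
      ; row-central = λ m → central (proj₁ (proj₂ stable (MR.idM m)))
      ; col-central = λ m → central (proj₁ (proj₁ stable (λ i → MR.idM i m)))
      ; e*-row      = λ m j → trans (V·-baseMat e* (rowR m) j)
          (trans (⟦⟧-cong (proj₂ (proj₂ stable (MR.idM m)) j)) (baseMat-idM m j))
      ; col-e       = λ m i → trans (baseMat-·V e (colR m) i)
          (trans (⟦⟧-cong (proj₂ (proj₁ stable (λ i → MR.idM i m)) i)) (baseMat-idM i m))
      }
      where
      central : ∀ p {x} → Commutes (baseMat A τ) x → Commutes x (baseMat A (MR.evalPoly p τ))
      central p τx≈xτ = commutes-cong (≈M-sym (baseMat-evalPoly p τ))
        (commutes-evalPoly (List.map φ p) (commutes-sym τx≈xτ))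

    open Coordinates frame

    HGτ⇔criterion : (g g' : Mat n) → IsInv g g' →
      (InHGτ n e e* (baseMat A τ) g → Criterion n e e* (baseMat A τ) g g')
      × (Criterion n e e* (baseMat A τ) g g' → InHGτ n e e* (baseMat A τ) g)
    HGτ⇔criterion g g' gg' =
      product≈idM⇒criterion ∘ HGτ⇒product≈idM gg' , product≈idM⇒HGτ gg' ∘ criterion⇒product≈idM

    evalAt-∑P : ∀ k (f : Fin k → Poly R n) g g' → evalAt A (∑P k f) g g' ≈ sumR k (λ i → evalAt A (f i) g g')
    evalAt-∑P zero    f g g' = 0#-homo
    evalAt-∑P (suc k) f g g' = +-congˡ (evalAt-∑P k (f ∘ suc) g g')

    evalAt-criterionPoly : ∀ g g' i j → evalAt A (criterionPoly (lift (i , j))) g g'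
      ≈ ([e*•]⁻¹ (E* V· g) ·M [•e]⁻¹ (g' ·V E)) i j - idM i j
    evalAt-criterionPoly g g' i j = +-cong
      (trans (evalAt-∑P n _ g g') (sumR-cong n (λ k → *-cong (evalAt-x i k) (evalAt-y k j))))
      (-‿cong (baseMat-idM i j))
      where
      evalAt-x : ∀ a b → evalAt A (LCP e*gP rowR a b) g g' ≈ [e*•]⁻¹ (E* V· g) a b
      evalAt-x a b = trans (evalAt-∑P n _ g g') (sumR-cong n (λ m → *-congʳ
        (trans (evalAt-∑P n _ g g') (sumR-cong n (λ k → *-congʳ (φ-fromℤ (e* k)))))))
      evalAt-y : ∀ a b → evalAt A (LCP g'eP colR a b) g g' ≈ [•e]⁻¹ (g' ·V E) a b
      evalAt-y a b = trans (evalAt-∑P n _ g g') (sumR-cong n (λ m → *-congʳ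
        (trans (evalAt-∑P n _ g g') (sumR-cong n (λ k → *-congˡ (φ-fromℤ (e k)))))))

    HGτ⇔criterionPoly≈0 : (g g' : Mat n) → IsInv g g' →
      (InHGτ n e e* (baseMat A τ) g → ∀ ij → evalAt A (criterionPoly ij) g g' ≈ 0#)
      × ((∀ ij → evalAt A (criterionPoly ij) g g' ≈ 0#) → InHGτ n e e* (baseMat A τ) g)
    HGτ⇔criterionPoly≈0 g g' gg' = vanishes , (λ P≈0 → product≈idM⇒HGτ gg' (product≈idM P≈0))
      where
      open import Algebra.Properties.Group +-group using (x≈y⇒x∙y⁻¹≈ε; x∙y⁻¹≈ε⇒x≈y)
      vanishes : InHGτ n e e* (baseMat A τ) g → ∀ ij → evalAt A (criterionPoly ij) g g' ≈ 0#
      vanishes hg (lift (i , j)) =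
        trans (evalAt-criterionPoly g g' i j) (x≈y⇒x∙y⁻¹≈ε (HGτ⇒product≈idM gg' hg i j))
      product≈idM : (∀ ij → evalAt A (criterionPoly ij) g g' ≈ 0#) →
        ([e*•]⁻¹ (E* V· g) ·M [•e]⁻¹ (g' ·V E)) ≈M idM
      product≈idM P≈0 i j =
        x∙y⁻¹≈ε⇒x≈y _ _ (trans (sym (evalAt-criterionPoly g g' i j)) (P≈0 (lift (i , j))))

lemma5p8 : {c ℓ : Level} (c' ℓ' : Level) (R : CommutativeRing c ℓ)
    (n : ℕ) (e e* : Fin n → ℤ) → pairℤ n e* e ≡ + 1 →
    (τ : MatOps.Mat R n) → MatOps.Stable R n e e* τ →
    ((A : Algebra' R c' ℓ') →
      let open MatOps (Algebra'.ring A) in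
      (g ginv : Mat n) → IsInv g ginv →
        (InHGτ n e e* (baseMat A τ) g → Criterion n e e* (baseMat A τ) g ginv)
        × (Criterion n e e* (baseMat A τ) g ginv → InHGτ n e e* (baseMat A τ) g))
    × Σ (Set c) (λ I → Σ (I → Poly R n) (λ P →
        (A : Algebra' R c' ℓ') →
          let open MatOps (Algebra'.ring A) in
          (g ginv : Mat n) → IsInv g ginv →
            (InHGτ n e e* (baseMat A τ) g →
               ∀ i → CommutativeRing._≈_ (Algebra'.ring A) (evalAt A (P i) g ginv) (CommutativeRing.0# (Algebra'.ring A)))
            × ((∀ i → CommutativeRing._≈_ (Algebra'.ring A) (evalAt A (P i) g ginv) (CommutativeRing.0# (Algebra'.ring A)))
               → InHGτ n e e* (baseMat A τ) g)))
lemma5p8 {c} c' ℓ' R n e e* _ τ stable =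
  HGτ⇔criterion , (Lift c (Fin n × Fin n) , criterionPoly , HGτ⇔criterionPoly≈0)
  where open StableEndomorphism R e e* τ stable
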